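{- Let $T:X\to X$ be a map such that $\mathcal F_T(n)=|\{x\in X:T^n(x)=x\}|<\infty$ for every $n\ge1$. Let $m\ge1$ have prime factorization $m=p_1^{a_1}\cdots p_r^{a_r}$, and for $n\ge1$ let $J=J(n)=\mathcal D(m)\setminus\mathcal D(n)$, where $\mathcal D(k)$ denotes the set of prime divisors of $k$. Write $\boldsymbol p_J^{\boldsymbol a_J}=\prod_{p_j\in J}p_j^{a_j}$. Then for every $n\ge1$, \[ \mathcal O_{T^m}(n)=\sum_{d\mid \boldsymbol p_J^{\boldsymbol a_J}}\frac{m}{d}\,\mathcal O_T\!\left(\frac{mn}{d}\right), \] where $T^m$ is the $m$-th iterate of $T$.
   Context: For a map $S:X\to X$, a closed orbit of length $n$ is a set $\{x,Sx,\dots,S^{n-1}x\}$ with $S^nx=x$ and of cardinality exactly $n$; $\mathcal O_S(n)$ denotes the number of closed orbits of $S$ of length $n$. -}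

module Defs where

open import Data.Nat using (ℕ; zero; suc; _+_; _*_; _^_; _/_; _≤_; _<_)
open import Data.Nat.Divisibility using (_∣_; _∣?_)
open import Data.Nat.Primality using (Prime; prime?)
open import Data.Fin using (Fin; toℕ)
open import Data.List using (List; upTo; map; filter)
open import Data.Nat.ListAction using (sum; product)
open import Data.Product using (Σ; ∃; _×_)
open import Function.Definitions using (Injective)
open import Function.Bundles using (_⇔_)
open import Relation.Nullary using (¬_; does)
open import Relation.Nullary.Decidable using (¬?; _×-dec_)
open import Relation.Binary.PropositionalEquality using (_≡_)
open import Data.Bool using (if_then_else_)

iter : {X : Set} → (X → X) → ℕ → X → X
iter S zero x = x
iter S (suc n) x = S (iter S n x)

OrbitSet : {X : Set} → (X → X) → ℕ → X → X → Set
OrbitSet S n x y = ∃ λ (i : Fin n) → iter S (toℕ i) x ≡ y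

-- x generates a closed orbit of length n:  S^n x = x and the n points
-- x, Sx, ..., S^{n-1}x are pairwise distinct (cardinality exactly n)
ClosedOrbit : {X : Set} → (X → X) → ℕ → X → Set
ClosedOrbit S n x = (iter S n x ≡ x) × Injective _≡_ _≡_ (λ (i : Fin n) → iter S (toℕ i) x)

SameOrbit : {X : Set} → (X → X) → ℕ → X → X → Set
SameOrbit S n x x' = ∀ y → OrbitSet S n x y ⇔ OrbitSet S n x' y

-- "O_S(n) = k": the closed orbits of length n (as subsets of X) are in
-- bijection with Fin k, via a choice of representatives r.
OrbitCount : {X : Set} → (X → X) → ℕ → ℕ → Set
OrbitCount {X} S n k =
  Σ (Fin k → X) λ r →
    (∀ i → ClosedOrbit S n (r i))
  × (∀ i j → SameOrbit S n (r i) (r j) → i ≡ j)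
  × (∀ x → ClosedOrbit S n x → ∃ λ i → SameOrbit S n x (r i))

-- "F_S(n) < ∞": the set {x : S^n x = x} is finite, i.e. enumerated
-- bijectively by some Fin k.
FinitelyManyFixed : {X : Set} → (X → X) → ℕ → Set
FinitelyManyFixed {X} S n =
  Σ ℕ λ k → Σ (Fin k → X) λ e →
    (∀ i → iter S n (e i) ≡ e i)
  × Injective _≡_ _≡_ e
  × (∀ x → iter S n x ≡ x → ∃ λ i → e i ≡ x)

val′ : ℕ → ℕ → ℕ → ℕ
val′ zero p m = 0
val′ (suc f) zero m = 0
val′ (suc f) (suc p) m =
  if does (suc p ∣? m) then suc (val′ f (suc p) (m / suc p)) else 0

-- v_p(m) for m ≥ 1 and p prime (fuel m suffices)
val : ℕ → ℕ → ℕ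
val p m = val′ m p m

primesBelow : ℕ → List ℕ
primesBelow m = filter prime? (upTo (suc m))

pJaJ : ℕ → ℕ → ℕ
pJaJ m n =
  product (map (λ p → p ^ val p m)
    (filter (λ p → (p ∣? m) ×-dec ¬? (p ∣? n)) (primesBelow m)))

sumDivisors : ℕ → (ℕ → ℕ) → ℕ
sumDivisors N f = sum (map (λ d → f d) (filter (λ d → d ∣? N) (map suc (upTo N))))

-- right-hand side  ∑_{d ∣ p_J^{a_J}} (m/d) · O_T(mn/d),  with O_T given by c
rhs : ℕ → ℕ → (ℕ → ℕ) → ℕ
rhs m n c = sumDivisors (pJaJ m n) (λ d → quot m d * c (quot (m * n) d))
  where
  quot : ℕ → ℕ → ℕ
  quot a zero = 0
  quot a (suc d) = a / suc d

-- The proof is organised around exact periods: L is the exact period of x when the return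
-- times of x are precisely the multiples of L, which is the same as x lying on a closed orbit
-- of length L.  If x has exact T-period L, its exact T^m-period n is characterised by
-- "L ∣ k·m ⇔ n ∣ k"; this forces L = g·n and m = g·d with g = gcd(L, m) and d coprime to n,
-- and the divisors of m coprime to n are exactly the divisors of pJaJ m n.  Conversely, for
-- m = g·d with d coprime to n, a closed T-orbit of length g·n splits under T^m into g closed
-- orbits of length n, represented by r, T r, ..., T^(g-1) r (Bézout gives the covering).
-- Orbit counts are transversals (systems of representatives); they add up over disjoint
-- classes, and the closed T^m-orbits of length n are the disjoint union, over d ∣ pJaJ m n,
-- of the classes "exact T-period (m/d)·n".  Finiteness of the fixed-point sets makes return
-- times decidable, which yields exact periods and the counts O_T(k) themselves.
module Submission where

open import Defs
open import Data.Bool using (if_then_else_)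
open import Data.Nat
  using ( ℕ; zero; suc; _+_; _*_; _^_; _∸_; _≤_; _<_; _≤?_; _%_; _/_; z≤n; s≤s
        ; NonZero; >-nonZero; >-nonZero⁻¹; ≢-nonZero; ≢-nonZero⁻¹ )
open import Data.Nat.Properties
  using ( +-comm; *-comm; *-assoc; *-identityˡ; *-cancelˡ-≡; *-cancelʳ-≡; suc-injective
        ; m*n≢0; m^n≢0; ≤-pred; ≤-trans; ≤-refl; ≤-antisym; ≤-total; ≰⇒>; m≤n⇒m<n∨m≡n
        ; m+[n∸m]≡n; m∸n+n≡m; m≤m*n )
open import Data.Nat.DivMod
  using ( m*n/n≡m; *-/-assoc; %-remove-+ˡ; %-remove-+ʳ; m∣n⇒o%n%m≡o%m; m≡m%n+[m/n]*n
        ; m*[n/m]≡n; m/n*n≡m; m/n<m; m%n<n; m<n⇒m%n≡m )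
open import Data.Nat.Divisibility
  using ( _∣_; _∣?_; divides; quotient; m∣n⇒n≡quotient*m; ∣⇒≤; ∣-refl; ∣-trans; ∣-antisym
        ; 0∣⇒≡0; ∣1⇒≡1; 1∣_; m∣m*n; n∣m*n; ∣n⇒∣m*n; m%n≡0⇒n∣m; *-cancelˡ-∣; *-monoʳ-∣ )
open import Data.Nat.Coprimality as Coprimality
  using (Coprime; coprime-divisor; coprime-/gcd; coprime-Bézout)
open import Data.Nat.GCD using (gcd; gcd[m,n]≢0; gcd[m,n]∣m; gcd[m,n]∣n; module Bézout)
open import Data.Nat.Primality
  using (Prime; prime?; ¬prime[0]; ¬prime[1]; euclidsLemma; prime⇒irreducible; prime⇒nonZero)
open import Data.Nat.Primality.Factorisation using (PrimeFactorisation; factorise)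
open import Data.Nat.ListAction using (sum; product)
open import Data.Nat.Induction using (<-wellFounded)
open import Data.Nat.Tactic.RingSolver using (solve-∀)
open import Data.Fin as Fin using (Fin; toℕ; fromℕ<)
open import Data.Fin.Properties
  using (toℕ-fromℕ<; toℕ-injective; toℕ<n; +↔⊎; *↔×; all?; any?; ¬∀⟶∃¬)
open import Data.List using (List; []; _∷_; map; filter; allFin; upTo)
open import Data.List.Properties using (map-cong)
open import Data.List.Relation.Unary.All as All using (All; []; _∷_)
open import Data.List.Relation.Unary.Any using (Any; here; there)
open import Data.List.Relation.Unary.AllPairs using (_∷_)
open import Data.List.Relation.Unary.Unique.Propositional using (Unique)
open import Data.List.Relation.Unary.Unique.Propositional.Properties
  using (filter⁺; allFin⁺; upTo⁺; map⁺)
open import Data.List.Membership.Propositional using (_∈_; find; lose)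
open import Data.List.Membership.Propositional.Properties
  using (∈-filter⁺; ∈-filter⁻; ∈-allFin; ∈-upTo⁺; ∈-map⁺; ∈-map⁻)
open import Data.Product using (Σ; ∃; _×_; _,_; proj₁; proj₂)
open import Data.Sum using (_⊎_; inj₁; inj₂)
open import Data.Empty using (⊥-elim)
open import Function.Bundles using (_⇔_; mk⇔; Equivalence; _↔_; Inverse)
open import Function.Construct.Composition using (_⇔-∘_)
open import Function.Construct.Symmetry using (⇔-sym)
open import Induction.WellFounded using (Acc; acc)
open import Relation.Nullary using (¬_; Dec; yes; no)
open import Relation.Nullary.Decidable using (¬?; _×-dec_; _→-dec_; map′; dec-true; dec-false)
open import Relation.Binary.PropositionalEquality
  using (_≡_; _≢_; refl; sym; trans; cong; cong₂; subst; subst₂; module ≡-Reasoning)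

open Equivalence using (to; from)
open ≡-Reasoning

module _ {X : Set} (S : X → X) where

  iter-+ : ∀ a b x → iter S (a + b) x ≡ iter S a (iter S b x)
  iter-+ zero    b x = refl
  iter-+ (suc a) b x = cong S (iter-+ a b x)

  iter-comm : ∀ a b x → iter S a (iter S b x) ≡ iter S b (iter S a x)
  iter-comm a b x = begin
    iter S a (iter S b x) ≡⟨ iter-+ a b x ⟨
    iter S (a + b) x      ≡⟨ cong (λ t → iter S t x) (+-comm a b) ⟩
    iter S (b + a) x      ≡⟨ iter-+ b a x ⟩
    iter S b (iter S a x) ∎

  iter-multiple : ∀ {L x} → iter S L x ≡ x → ∀ q → iter S (q * L) x ≡ x
  iter-multiple         ret zero    = refl
  iter-multiple {L} {x} ret (suc q) = begin
    iter S (L + q * L) x        ≡⟨ iter-+ L (q * L) x ⟩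
    iter S L (iter S (q * L) x) ≡⟨ cong (iter S L) (iter-multiple ret q) ⟩
    iter S L x                  ≡⟨ ret ⟩
    x                           ∎

  iter-+-period : ∀ {L x} → iter S L x ≡ x → ∀ a {t} → L ∣ t → iter S (a + t) x ≡ iter S a x
  iter-+-period {x = x} ret a (divides q refl) =
    trans (iter-+ a _ x) (cong (iter S a) (iter-multiple ret q))

  iter-mod : ∀ {L x} .{{_ : NonZero L}} → iter S L x ≡ x → ∀ a → iter S a x ≡ iter S (a % L) x
  iter-mod {L} {x} ret a = begin
    iter S a x                       ≡⟨ cong (λ t → iter S t x) (m≡m%n+[m/n]*n a L) ⟩
    iter S (a % L + a / L * L) x     ≡⟨ iter-+-period ret (a % L) (n∣m*n (a / L)) ⟩
    iter S (a % L) x                 ∎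

  orbit-return : ∀ {L x} .{{_ : NonZero L}} → iter S L x ≡ x →
                 ∀ s → ∃ λ t → iter S t (iter S s x) ≡ x
  orbit-return {L} {x} ret s = s * L ∸ s , (begin
    iter S (s * L ∸ s) (iter S s x) ≡⟨ iter-+ (s * L ∸ s) s x ⟨
    iter S (s * L ∸ s + s) x        ≡⟨ cong (λ t → iter S t x) (m∸n+n≡m (m≤m*n s L)) ⟩
    iter S (s * L) x                ≡⟨ iter-multiple ret s ⟩
    x                               ∎)

  periodic-shift : ∀ {L x} → iter S L x ≡ x → ∀ s → iter S L (iter S s x) ≡ iter S s x
  periodic-shift {L} {x} ret s = trans (iter-comm L s x) (cong (iter S s) ret)

iter-* : {X : Set} (S : X → X) → ∀ m k x → iter (iter S m) k x ≡ iter S (k * m) x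
iter-* S m zero    x = refl
iter-* S m (suc k) x = trans (cong (iter S m) (iter-* S m k x)) (sym (iter-+ S m (k * m) x))

∣-gap⇒≡-mod : ∀ {L a b} .{{_ : NonZero L}} → a ≤ b → L ∣ b ∸ a → a % L ≡ b % L
∣-gap⇒≡-mod {L} {a} a≤b L∣gap = trans (sym (%-remove-+ʳ a L∣gap)) (cong (_% L) (m+[n∸m]≡n a≤b))

mod-coarsen : ∀ {g L a b} .{{_ : NonZero g}} .{{_ : NonZero L}} →
              g ∣ L → a % L ≡ b % L → a % g ≡ b % g
mod-coarsen {g} {L} {a} {b} g∣L eq = begin
  a % g      ≡⟨ m∣n⇒o%n%m≡o%m g L a g∣L ⟨
  a % L % g  ≡⟨ cong (_% g) eq ⟩
  b % L % g  ≡⟨ m∣n⇒o%n%m≡o%m g L b g∣L ⟩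
  b % g      ∎

ExactPeriod : {X : Set} → (X → X) → ℕ → X → Set
ExactPeriod S L x = ∀ k → iter S k x ≡ x ⇔ L ∣ k

module _ {X : Set} {S : X → X} where

  exact-return : ∀ {L x} → ExactPeriod S L x → iter S L x ≡ x
  exact-return {L} p = from (p L) ∣-refl

  exact-unique : ∀ {L L′ x} → ExactPeriod S L x → ExactPeriod S L′ x → L ≡ L′
  exact-unique {L} {L′} p p′ = ∣-antisym (to (p L′) (exact-return p′)) (to (p′ L) (exact-return p))

  least⇒exact : ∀ {a x} → iter S (suc a) x ≡ x → (∀ b → b < a → iter S (suc b) x ≢ x) →
                ExactPeriod S (suc a) x
  least⇒exact {a} {x} ret minimal k = mk⇔ divides-k (iter-+-period S ret 0)
    where
    only-zero-returns : ∀ r → r < suc a → iter S r x ≡ x → r ≡ 0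
    only-zero-returns zero    _         _     = refl
    only-zero-returns (suc b) (s≤s b<a) ret-b = ⊥-elim (minimal b b<a ret-b)

    divides-k : iter S k x ≡ x → suc a ∣ k
    divides-k ret-k = m%n≡0⇒n∣m k (suc a)
      (only-zero-returns (k % suc a) (m%n<n k (suc a)) (trans (sym (iter-mod S ret k)) ret-k))

  exact-shift : ∀ {L x} .{{_ : NonZero L}} → ExactPeriod S L x →
                ∀ s → ExactPeriod S L (iter S s x)
  exact-shift {L} {x} p s k = mk⇔ divides-k returns
    where
    back = orbit-return S (exact-return p) s
    t = proj₁ back

    divides-k : iter S k (iter S s x) ≡ iter S s x → L ∣ k
    divides-k ret = to (p k) (begin
      iter S k x                            ≡⟨ cong (iter S k) (proj₂ back) ⟨
      iter S k (iter S t (iter S s x))      ≡⟨ iter-comm S k t _ ⟩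
      iter S t (iter S k (iter S s x))      ≡⟨ cong (iter S t) ret ⟩
      iter S t (iter S s x)                 ≡⟨ proj₂ back ⟩
      x                                     ∎)

    returns : L ∣ k → iter S k (iter S s x) ≡ iter S s x
    returns L∣k = trans (iter-comm S k s x) (cong (iter S s) (from (p k) L∣k))

  exact-∣-gap : ∀ {L x} .{{_ : NonZero L}} → ExactPeriod S L x →
                ∀ {a b} → a ≤ b → iter S a x ≡ iter S b x → L ∣ b ∸ a
  exact-∣-gap {x = x} p {a} {b} a≤b eq = to (exact-shift p a (b ∸ a)) (begin
    iter S (b ∸ a) (iter S a x) ≡⟨ iter-+ S (b ∸ a) a x ⟨
    iter S (b ∸ a + a) x        ≡⟨ cong (λ t → iter S t x) (m∸n+n≡m a≤b) ⟩
    iter S b x                  ≡⟨ eq ⟨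
    iter S a x                  ∎)

  exact-mod : ∀ {L x} .{{_ : NonZero L}} → ExactPeriod S L x →
              ∀ {a b} → iter S a x ≡ iter S b x → a % L ≡ b % L
  exact-mod p {a} {b} eq with ≤-total a b
  ... | inj₁ a≤b = ∣-gap⇒≡-mod a≤b (exact-∣-gap p a≤b eq)
  ... | inj₂ b≤a = sym (∣-gap⇒≡-mod b≤a (exact-∣-gap p b≤a (sym eq)))

  closed⇒exact : ∀ {L x} .{{_ : NonZero L}} → ClosedOrbit S L x → ExactPeriod S L x
  closed⇒exact {suc a} {x} (ret , injective) = least⇒exact ret minimal
    where
    minimal : ∀ b → b < a → iter S (suc b) x ≢ x
    minimal b b<a ret-b
      with injective {Fin.suc (fromℕ< b<a)} {Fin.zero}
             (subst (λ t → iter S (suc t) x ≡ x) (sym (toℕ-fromℕ< b<a)) ret-b)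
    ... | ()

  exact⇒closed : ∀ {L x} .{{_ : NonZero L}} → ExactPeriod S L x → ClosedOrbit S L x
  exact⇒closed {L} p = exact-return p , λ {i} {j} eq → toℕ-injective (begin
    toℕ i      ≡⟨ m<n⇒m%n≡m (toℕ<n i) ⟨
    toℕ i % L  ≡⟨ exact-mod p eq ⟩
    toℕ j % L  ≡⟨ m<n⇒m%n≡m (toℕ<n j) ⟩
    toℕ j      ∎)

  iterate-returns : ∀ {L x} → ExactPeriod S L x → ∀ m k → iter (iter S m) k x ≡ x ⇔ L ∣ k * m
  iterate-returns {x = x} p m k =
    p (k * m) ⇔-∘ mk⇔ (trans (sym (iter-* S m k x))) (trans (iter-* S m k x))

  exact-iterate : ∀ {L m n x} → ExactPeriod S L x → (∀ k → L ∣ k * m ⇔ n ∣ k) →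
                  ExactPeriod (iter S m) n x
  exact-iterate {m = m} p multiples k = multiples k ⇔-∘ iterate-returns p m k

  exact-iterate⁻ : ∀ {L m n x} → ExactPeriod S L x → ExactPeriod (iter S m) n x →
                   ∀ k → L ∣ k * m ⇔ n ∣ k
  exact-iterate⁻ {m = m} p p′ k = p′ k ⇔-∘ ⇔-sym (iterate-returns p m k)

module _ {X : Set} (S : X → X) where

  in-orbit : ∀ {L x} .{{_ : NonZero L}} → iter S L x ≡ x → ∀ a → OrbitSet S L x (iter S a x)
  in-orbit {L} {x} ret a = fromℕ< (m%n<n a L) , (begin
    iter S (toℕ (fromℕ< (m%n<n a L))) x ≡⟨ cong (λ t → iter S t x) (toℕ-fromℕ< (m%n<n a L)) ⟩
    iter S (a % L) x                    ≡⟨ iter-mod S ret a ⟨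
    iter S a x                          ∎)

  sameOrbit-intro : ∀ {L x} .{{_ : NonZero L}} → iter S L x ≡ x →
                    ∀ s → SameOrbit S L x (iter S s x)
  sameOrbit-intro {L} {x} ret s z = mk⇔ forward backward
    where
    y = iter S s x
    back = orbit-return S ret s
    t = proj₁ back

    forward : OrbitSet S L x z → OrbitSet S L y z
    forward (i , refl) =
      subst (OrbitSet S L y) y-to-x (in-orbit (periodic-shift S {L} ret s) (toℕ i + t))
      where
      y-to-x : iter S (toℕ i + t) y ≡ iter S (toℕ i) x
      y-to-x = trans (iter-+ S (toℕ i) t y) (cong (iter S (toℕ i)) (proj₂ back))

    backward : OrbitSet S L y z → OrbitSet S L x z
    backward (i , refl) = subst (OrbitSet S L x) (iter-+ S (toℕ i) s x) (in-orbit ret (toℕ i + s))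

  sameOrbit-elim : ∀ {L x y} .{{_ : NonZero L}} → SameOrbit S L x y → ∃ λ s → y ≡ iter S s x
  sameOrbit-elim {suc _} {x} {y} same =
    let (i , eq) = from (same y) (Fin.zero , refl) in toℕ i , sym eq

  sameOrbit-refl : ∀ {L x} → SameOrbit S L x x
  sameOrbit-refl z = mk⇔ (λ o → o) (λ o → o)

  sameOrbit-sym : ∀ {L x y} → SameOrbit S L x y → SameOrbit S L y x
  sameOrbit-sym same z = mk⇔ (from (same z)) (to (same z))

  sameOrbit-trans : ∀ {L x y w} → SameOrbit S L x y → SameOrbit S L y w → SameOrbit S L x w
  sameOrbit-trans same same′ z =
    mk⇔ (λ o → to (same′ z) (to (same z) o)) (λ o → from (same z) (from (same′ z) o))

  closed-resp : ∀ {L x y} .{{_ : NonZero L}} → SameOrbit S L x y →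
                ClosedOrbit S L x → ClosedOrbit S L y
  closed-resp same closed with sameOrbit-elim same
  ... | s , refl = exact⇒closed (exact-shift (closed⇒exact closed) s)

  sameOrbit-meet : ∀ {L x y} .{{_ : NonZero L}} → iter S L x ≡ x → iter S L y ≡ y →
                   ∀ a b → iter S a y ≡ iter S b x → SameOrbit S L x y
  sameOrbit-meet {L} {x} {y} ret-x ret-y a b meet =
    subst (SameOrbit S L x) y≡ (sameOrbit-intro ret-x (t + b))
    where
    back = orbit-return S ret-y a
    t = proj₁ back
    y≡ : iter S (t + b) x ≡ y
    y≡ = begin
      iter S (t + b) x            ≡⟨ iter-+ S t b x ⟩
      iter S t (iter S b x)       ≡⟨ cong (iter S t) meet ⟨
      iter S t (iter S a y)       ≡⟨ proj₂ back ⟩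
      y                           ∎

module _ {P : ℕ → Set} (P? : ∀ n → Dec (P n)) where

  least-below : ∀ M → (∃ λ a → P a × (∀ b → b < a → ¬ P b)) ⊎ (∀ b → b < M → ¬ P b)
  least-below zero = inj₂ (λ b ())
  least-below (suc M) with least-below M
  ... | inj₁ found = inj₁ found
  ... | inj₂ none with P? M
  ...   | yes pM = inj₁ (M , pM , none)
  ...   | no ¬pM = inj₂ below
    where
    below : ∀ b → b < suc M → ¬ P b
    below b (s≤s b≤M) with m≤n⇒m<n∨m≡n b≤M
    ... | inj₁ b<M  = none b b<M
    ... | inj₂ refl = ¬pM

  least : ∀ {N} → P N → ∃ λ a → P a × (∀ b → b < a → ¬ P b)
  least {N} pN with least-below (suc N)
  ... | inj₁ found = found
  ... | inj₂ none  = ⊥-elim (none N ≤-refl pN)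

module _ {X : Set} {S : X → X} where

  periodic-≟ : ∀ {N x y} → FinitelyManyFixed S N →
               iter S N x ≡ x → iter S N y ≡ y → Dec (x ≡ y)
  periodic-≟ {x = x} {y} (_ , e , _ , injective , complete) ret-x ret-y
    with complete x ret-x | complete y ret-y
  ... | i , ex | j , ey with i Fin.≟ j
  ...   | yes refl = yes (trans (sym ex) ey)
  ...   | no i≢j   = no (λ x≡y → i≢j (injective (trans ex (trans x≡y (sym ey)))))

  exact-period-exists : ∀ {N x} .{{_ : NonZero N}} → FinitelyManyFixed S N → iter S N x ≡ x →
                        ∃ λ a → ExactPeriod S (suc a) x
  exact-period-exists {suc N} {x} fixed ret
    with least (λ b → periodic-≟ {suc N} fixed (periodic-shift S {suc N} ret (suc b)) ret) {N} ret
  ... | a , ret-a , minimal = a , least⇒exact ret-a minimal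

-- OrbitCount S n k is the instance R = SameOrbit S n, C = ClosedOrbit S n.
Transversal : {X : Set} → (X → X → Set) → (X → Set) → ℕ → Set
Transversal {X} R C k =
  Σ (Fin k → X) λ r →
    (∀ i → C (r i))
  × (∀ i j → R (r i) (r j) → i ≡ j)
  × (∀ x → C x → ∃ λ i → R x (r i))

module _ {X : Set} {R : X → X → Set} where

  transversal-via : ∀ {C k} {I : Set} → Fin k ↔ I → (r : I → X) →
    (∀ i → C (r i)) → (∀ i j → R (r i) (r j) → i ≡ j) → (∀ x → C x → ∃ λ i → R x (r i)) →
    Transversal R C k
  transversal-via {C} ι r member separated cover =
    (λ a → r (I.to a)) , (λ a → member (I.to a)) , separated′ , cover′
    where
    module I = Inverse ι

    separated′ : ∀ a b → R (r (I.to a)) (r (I.to b)) → a ≡ b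
    separated′ a b rel = begin
      a               ≡⟨ I.strictlyInverseʳ a ⟨
      I.from (I.to a) ≡⟨ cong I.from (separated _ _ rel) ⟩
      I.from (I.to b) ≡⟨ I.strictlyInverseʳ b ⟩
      b               ∎

    cover′ : ∀ x → C x → ∃ λ a → R x (r (I.to a))
    cover′ x cx = let (i , rel) = cover x cx in
      I.from i , subst (λ j → R x (r j)) (sym (I.strictlyInverseˡ i)) rel

  transversal-≐ : ∀ {C C′ k} → (∀ {x} → C x → C′ x) → (∀ {x} → C′ x → C x) →
                  Transversal R C k → Transversal R C′ k
  transversal-≐ to′ from′ (r , member , separated , cover) =
    r , (λ i → to′ (member i)) , separated , (λ x c → cover x (from′ c))

  transversal-⊎ : ∀ {A B k l} → (∀ {x y} → R x y → R y x) →
                  (∀ {x y} → A x → B y → ¬ R x y) → Transversal R A k → Transversal R B l →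
                  Transversal R (λ x → A x ⊎ B x) (k + l)
  transversal-⊎ {A} {B} R-sym apart (rA , memA , sepA , covA) (rB , memB , sepB , covB) =
    transversal-via +↔⊎ r member separated cover
    where
    r : Fin _ ⊎ Fin _ → X
    r (inj₁ i) = rA i
    r (inj₂ j) = rB j

    member : ∀ i → A (r i) ⊎ B (r i)
    member (inj₁ i) = inj₁ (memA i)
    member (inj₂ j) = inj₂ (memB j)

    separated : ∀ i j → R (r i) (r j) → i ≡ j
    separated (inj₁ i) (inj₁ j) rel = cong inj₁ (sepA i j rel)
    separated (inj₂ i) (inj₂ j) rel = cong inj₂ (sepB i j rel)
    separated (inj₁ i) (inj₂ j) rel = ⊥-elim (apart (memA i) (memB j) rel)
    separated (inj₂ i) (inj₁ j) rel = ⊥-elim (apart (memA j) (memB i) (R-sym rel))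

    cover : ∀ x → A x ⊎ B x → ∃ λ i → R x (r i)
    cover x (inj₁ ax) = let (i , rel) = covA x ax in inj₁ i , rel
    cover x (inj₂ bx) = let (j , rel) = covB x bx in inj₂ j , rel

  transversal-⋃ : ∀ {A : Set} (C : A → X → Set) (f : A → ℕ) → (∀ {x y} → R x y → R y x) →
    (ds : List A) → Unique ds →
    (∀ {d} → d ∈ ds → Transversal R (C d) (f d)) →
    (∀ {d d′ x y} → d ∈ ds → d′ ∈ ds → C d x → C d′ y → R x y → d ≡ d′) →
    Transversal R (λ x → Any (λ d → C d x) ds) (sum (map f ds))
  transversal-⋃ C f R-sym [] _ _ _ = (λ ()) , (λ ()) , (λ ()) , (λ x ())
  transversal-⋃ C f R-sym (d ∷ ds) (d∉ds ∷ unique) each separated =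
    transversal-≐ (λ { (inj₁ c) → here c ; (inj₂ c) → there c })
                  (λ { (here c) → inj₁ c ; (there c) → inj₂ c })
      (transversal-⊎ R-sym apart (each (here refl))
        (transversal-⋃ C f R-sym ds unique (λ d∈ → each (there d∈))
          (λ d∈ d′∈ → separated (there d∈) (there d′∈))))
    where
    apart : ∀ {x y} → C d x → Any (λ d′ → C d′ y) ds → ¬ R x y
    apart cx in-ds rel =
      let (d′ , d′∈ds , cy) = find in-ds in
      All.lookup d∉ds d′∈ds (separated (here refl) (there d′∈ds) cx cy rel)

-- A decidable equivalence R on a class C enumerated by e : Fin K → X has a transversal:
-- the indices that come first in their class, each standing for that class.
module _ {X : Set} {R : X → X → Set} {C : X → Set}
         (R-refl : ∀ {x} → R x x) (R-sym : ∀ {x y} → R x y → R y x)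
         (R-trans : ∀ {x y z} → R x y → R y z → R x z) (C-resp : ∀ {x y} → R x y → C x → C y)
         {K : ℕ} (e : Fin K → X) (enumerates : ∀ x → C x → ∃ λ i → e i ≡ x)
         (C? : ∀ i → Dec (C (e i))) (R? : ∀ i j → Dec (R (e i) (e j))) where

  First : Fin K → Set
  First i = C (e i) × (∀ j → R (e i) (e j) → toℕ i ≤ toℕ j)

  First? : ∀ i → Dec (First i)
  First? i = C? i ×-dec all? (λ j → R? i j →-dec toℕ i ≤? toℕ j)

  first-of-class : ∀ i → C (e i) → Acc _<_ (toℕ i) → ∃ λ j → R (e i) (e j) × First j
  first-of-class i ci (acc smaller) with First? i
  ... | yes first = i , R-refl , first
  ... | no ¬first
    with ¬∀⟶∃¬ K _ (λ j → R? i j →-dec toℕ i ≤? toℕ j) (λ minimal → ¬first (ci , minimal))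
  ...   | j , ¬minimal with R? i j
  ...     | no ¬rel = ⊥-elim (¬minimal (λ rel → ⊥-elim (¬rel rel)))
  ...     | yes rel =
    let j<i = ≰⇒> (λ i≤j → ¬minimal (λ _ → i≤j))
        (k , rel′ , first) = first-of-class j (C-resp rel ci) (smaller j<i)
    in k , R-trans rel rel′ , first

  firsts : List (Fin K)
  firsts = filter First? (allFin K)

  transversal-of-enumeration : Σ ℕ (Transversal R C)
  transversal-of-enumeration =
    _ , transversal-≐ {R = R} {C = λ x → Any (λ i → R x (e i)) firsts} in-C from-C
          (transversal-⋃ (λ i x → R x (e i)) (λ _ → 1) R-sym firsts (filter⁺ First? (allFin⁺ K))
             singleton separated)
    where
    first-∈ : ∀ {i} → i ∈ firsts → First i
    first-∈ i∈ = proj₂ (∈-filter⁻ First? {xs = allFin K} i∈)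

    singleton : ∀ {i} → i ∈ firsts → Transversal R (λ x → R x (e i)) 1
    singleton {i} _ =
      (λ _ → e i) , (λ _ → R-refl) , (λ { Fin.zero Fin.zero _ → refl }) , (λ x rel → Fin.zero , rel)

    separated : ∀ {i j x y} → i ∈ firsts → j ∈ firsts → R x (e i) → R y (e j) → R x y → i ≡ j
    separated {i} {j} i∈ j∈ rx ry rxy =
      toℕ-injective (≤-antisym (proj₂ (first-∈ i∈) j rel) (proj₂ (first-∈ j∈) i (R-sym rel)))
      where
      rel : R (e i) (e j)
      rel = R-trans (R-sym rx) (R-trans rxy ry)

    in-C : ∀ {x} → Any (λ i → R x (e i)) firsts → C x
    in-C any = let (i , i∈ , rel) = find any in C-resp (R-sym rel) (proj₁ (first-∈ i∈))

    from-C : ∀ {x} → C x → Any (λ i → R x (e i)) firsts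
    from-C {x} cx =
      let (i , ei≡x) = enumerates x cx
          (j , rel , first) = first-of-class i (subst C (sym ei≡x) cx) (<-wellFounded (toℕ i))
      in lose (∈-filter⁺ First? (∈-allFin j) first) (subst (λ z → R z (e j)) ei≡x rel)

orbit-count : ∀ {X} (S : X → X) k .{{_ : NonZero k}} → FinitelyManyFixed S k →
              Σ ℕ (OrbitCount S k)
orbit-count S k fixed@(_ , e , periodic , _ , complete) =
  transversal-of-enumeration (sameOrbit-refl S) (sameOrbit-sym S) (sameOrbit-trans S)
    (closed-resp S) e (λ x closed → complete x (proj₁ closed)) closed? sameOrbit?
  where
  -- Points on the orbit of e i are fixed by S^k, so their equality is decidable.
  along : ∀ i (a b : Fin k) → Dec (iter S (toℕ a) (e i) ≡ iter S (toℕ b) (e i))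
  along i a b = periodic-≟ {N = k} fixed (periodic-shift S {k} (periodic i) (toℕ a))
                                        (periodic-shift S {k} (periodic i) (toℕ b))

  closed? : ∀ i → Dec (ClosedOrbit S k (e i))
  closed? i = map′ (λ inj → periodic i , λ {a} {b} → inj a b) (λ closed a b → proj₂ closed)
    (all? λ a → all? λ b → along i a b →-dec a Fin.≟ b)

  sameOrbit? : ∀ i j → Dec (SameOrbit S k (e i) (e j))
  sameOrbit? i j = map′
    (λ (t , eq) → subst (SameOrbit S k (e i)) eq (sameOrbit-intro S (periodic i) (toℕ t)))
    (λ same → from (same (e j)) (in-orbit S (periodic j) 0))
    (any? λ t → periodic-≟ {N = k} fixed (periodic-shift S {k} (periodic i) (toℕ t))
                                         (periodic j))

coprime-cancel : ∀ g {d n} .{{_ : NonZero g}} → Coprime d n →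
                 ∀ k → g * n ∣ k * (g * d) ⇔ n ∣ k
coprime-cancel g {d} {n} cop k = mk⇔ cancel extend
  where
  rearrange : k * (g * d) ≡ g * (d * k)
  rearrange = trans (*-comm k (g * d)) (*-assoc g d k)

  cancel : g * n ∣ k * (g * d) → n ∣ k
  cancel gn∣ =
    coprime-divisor (Coprimality.sym cop) (*-cancelˡ-∣ g (subst (g * n ∣_) rearrange gn∣))

  extend : n ∣ k → g * n ∣ k * (g * d)
  extend n∣k = subst (g * n ∣_) (sym rearrange) (*-monoʳ-∣ g (∣n⇒∣m*n d n∣k))

gcd-structure : ∀ {L m n} .{{_ : NonZero L}} → (∀ k → L ∣ k * m ⇔ n ∣ k) →
                ∃ λ d → L ≡ gcd L m * n × m ≡ gcd L m * d × Coprime d n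
gcd-structure {L} {m} {n} multiples =
  d , subst (λ t → L ≡ g * t) (sym n≡L₁) L≡ , m≡ , subst (Coprime d) (sym n≡L₁) d⊥L₁
  where
  g = gcd L m
  instance
    g≢0 : NonZero g
    g≢0 = ≢-nonZero (gcd[m,n]≢0 L m (inj₁ (≢-nonZero⁻¹ L)))
  L₁ = L / g
  d = m / g

  L≡ : L ≡ g * L₁
  L≡ = sym (m*[n/m]≡n (gcd[m,n]∣m L m))

  m≡ : m ≡ g * d
  m≡ = sym (m*[n/m]≡n (gcd[m,n]∣n L m))

  d⊥L₁ : Coprime d L₁
  d⊥L₁ = Coprimality.sym (coprime-/gcd L m)

  multiples₁ : ∀ k → L ∣ k * m ⇔ L₁ ∣ k
  multiples₁ k = mk⇔
    (λ L∣ → to (coprime-cancel g d⊥L₁ k) (subst₂ (λ a b → a ∣ k * b) L≡ m≡ L∣))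
    (λ L₁∣k → subst₂ (λ a b → a ∣ k * b) (sym L≡) (sym m≡) (from (coprime-cancel g d⊥L₁ k) L₁∣k))

  n≡L₁ : n ≡ L₁
  n≡L₁ = ∣-antisym (to (multiples L₁) (from (multiples₁ L₁) ∣-refl))
                   (to (multiples₁ n) (from (multiples n) ∣-refl))

coprime-solvable : ∀ {d n} .{{_ : NonZero n}} → Coprime d n → ∀ q → ∃ λ k → n ∣ k * d + q
coprime-solvable {d} {suc n′} cop q with coprime-Bézout cop
... | Bézout.+- x y 1+yn≡xd = n′ * x * q , divides (q + n′ * q * y) (begin
  n′ * x * q * d + q             ≡⟨ reassociate n′ x q d ⟩
  n′ * q * (x * d) + q           ≡⟨ cong (λ t → n′ * q * t + q) 1+yn≡xd ⟨
  n′ * q * (1 + y * suc n′) + q  ≡⟨ collect n′ x q y ⟩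
  (q + n′ * q * y) * suc n′      ∎)
  where
  reassociate : ∀ n′ x q d → n′ * x * q * d + q ≡ n′ * q * (x * d) + q
  reassociate = solve-∀
  collect : ∀ n′ x q y → n′ * q * (1 + y * suc n′) + q ≡ (q + n′ * q * y) * suc n′
  collect = solve-∀
... | Bézout.-+ x y 1+xd≡yn = x * q , divides (q * y) (begin
  x * q * d + q      ≡⟨ reassociate x q d ⟩
  q * (1 + x * d)    ≡⟨ cong (q *_) 1+xd≡yn ⟩
  q * (y * suc n′)   ≡⟨ *-assoc q y (suc n′) ⟨
  q * y * suc n′     ∎)
  where
  reassociate : ∀ x q d → x * q * d + q ≡ q * (1 + x * d)
  reassociate = solve-∀

val′-divisible : ∀ f p m → suc p ∣ m → val′ (suc f) (suc p) m ≡ suc (val′ f (suc p) (m / suc p))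
val′-divisible f p m p∣m =
  cong (λ b → if b then suc (val′ f (suc p) (m / suc p)) else 0) (dec-true (suc p ∣? m) p∣m)

val′-indivisible : ∀ f p m → ¬ suc p ∣ m → val′ (suc f) (suc p) m ≡ 0
val′-indivisible f p m p∤m =
  cong (λ b → if b then suc (val′ f (suc p) (m / suc p)) else 0) (dec-false (suc p ∣? m) p∤m)

val′-spec : ∀ f {p m} .{{_ : NonZero m}} → Prime p → m ≤ f →
            ∃ λ r → m ≡ p ^ val′ f p m * r × ¬ p ∣ r
val′-spec zero    {m = suc _} _ ()
val′-spec (suc f) {zero}       p-prime _ = ⊥-elim (¬prime[0] p-prime)
val′-spec (suc f) {suc zero}   p-prime _ = ⊥-elim (¬prime[1] p-prime)
val′-spec (suc f) {p@(suc (suc p′))} {m} p-prime m≤f with p ∣? m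
... | no p∤m rewrite val′-indivisible f (suc p′) m p∤m = m , sym (*-identityˡ m) , p∤m
... | yes p∣m rewrite val′-divisible f (suc p′) m p∣m =
  let (r , q≡ , p∤r) = val′-spec f {{q≢0}} p-prime q≤f in
  r , (begin
    m                     ≡⟨ m/n*n≡m p∣m ⟨
    q * p                 ≡⟨ cong (_* p) q≡ ⟩
    p ^ v * r * p         ≡⟨ rotate (p ^ v) r p ⟩
    p * p ^ v * r         ∎) , p∤r
  where
  q = m / p
  v = val′ f p q
  q≢0 : NonZero q
  q≢0 = ≢-nonZero (λ q≡0 → ≢-nonZero⁻¹ m (trans (sym (m/n*n≡m p∣m)) (cong (_* p) q≡0)))
  q≤f : q ≤ f
  q≤f = ≤-pred (≤-trans (m/n<m m p (s≤s (s≤s z≤n))) m≤f)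
  rotate : ∀ a b c → a * b * c ≡ c * a * b
  rotate = solve-∀

val-spec : ∀ {p m} .{{_ : NonZero m}} → Prime p → ∃ λ r → m ≡ p ^ val p m * r × ¬ p ∣ r
val-spec p-prime = val′-spec _ p-prime ≤-refl

coprime-by-primes : ∀ {a b} .{{_ : NonZero a}} → (∀ {p} → Prime p → p ∣ a → ¬ p ∣ b) →
                    Coprime a b
coprime-by-primes {a} no-common {e} (e∣a , e∣b) = only-unit (factorise e {{e≢0}})
  where
  e≢0 : NonZero e
  e≢0 = ≢-nonZero (λ e≡0 → ≢-nonZero⁻¹ a (0∣⇒≡0 (subst (_∣ a) e≡0 e∣a)))

  only-unit : PrimeFactorisation e → e ≡ 1
  only-unit record { factors = [] ; isFactorisation = e≡1 } = e≡1
  only-unit record { factors = p ∷ _ ; isFactorisation = e≡ ; factorsPrime = p-prime ∷ _ } =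
    ⊥-elim (no-common p-prime (∣-trans p∣e e∣a) (∣-trans p∣e e∣b))
    where
    p∣e : p ∣ e
    p∣e = subst (p ∣_) (sym e≡) (m∣m*n _)

prime-∣-pow : ∀ {q p} → Prime q → Prime p → ∀ v → q ∣ p ^ v → q ≡ p
prime-∣-pow q-prime p-prime zero q∣1 = ⊥-elim (¬prime[1] (subst Prime (∣1⇒≡1 q∣1) q-prime))
prime-∣-pow {p = p} q-prime p-prime (suc v) q∣ with euclidsLemma p (p ^ v) q-prime q∣
... | inj₂ q∣pᵛ = prime-∣-pow q-prime p-prime v q∣pᵛ
... | inj₁ q∣p with prime⇒irreducible p-prime q∣p
...   | inj₁ q≡1 = ⊥-elim (¬prime[1] (subst Prime q≡1 q-prime))
...   | inj₂ q≡p = q≡p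

coprime-*-∣ : ∀ {a b m} → Coprime a b → a ∣ m → b ∣ m → a * b ∣ m
coprime-*-∣ {a} {b} a⊥b (divides k refl) b∣ka =
  subst (a * b ∣_) (*-comm a k)
    (*-monoʳ-∣ a (coprime-divisor (Coprimality.sym a⊥b) (subst (b ∣_) (*-comm k a) b∣ka)))

module _ (v : ℕ → ℕ) where

  -- ∏_{p ∈ ps} p^(v p); pJaJ m n is the case v = val · m, ps = J m n.
  ∏pow : List ℕ → ℕ
  ∏pow ps = product (map (λ p → p ^ v p) ps)

  pow-∣-∏pow : ∀ {p ps} → p ∈ ps → p ^ v p ∣ ∏pow ps
  pow-∣-∏pow {ps = q ∷ ps} (here refl) = m∣m*n (∏pow ps)
  pow-∣-∏pow {ps = q ∷ ps} (there p∈) = ∣n⇒∣m*n (q ^ v q) (pow-∣-∏pow p∈)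

  prime-∣-∏pow : ∀ {q} ps → Prime q → All Prime ps → q ∣ ∏pow ps → q ∈ ps
  prime-∣-∏pow [] q-prime [] q∣1 = ⊥-elim (¬prime[1] (subst Prime (∣1⇒≡1 q∣1) q-prime))
  prime-∣-∏pow (p ∷ ps) q-prime (p-prime ∷ primes) q∣
    with euclidsLemma (p ^ v p) (∏pow ps) q-prime q∣
  ... | inj₁ q∣pᵛ = here (prime-∣-pow q-prime p-prime (v p) q∣pᵛ)
  ... | inj₂ q∣∏  = there (prime-∣-∏pow ps q-prime primes q∣∏)

  ∏pow-coprime : ∀ {n} .{{_ : NonZero n}} ps → All Prime ps → All (λ p → ¬ p ∣ n) ps →
                 Coprime (∏pow ps) n
  ∏pow-coprime ps primes p∤n = Coprimality.sym (coprime-by-primes (λ q-prime q∣n q∣∏ →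
    All.lookup p∤n (prime-∣-∏pow ps q-prime primes q∣∏) q∣n))

  ∏pow-∣ : ∀ {m} ps → Unique ps → All Prime ps → (∀ {p} → p ∈ ps → p ^ v p ∣ m) →
           ∏pow ps ∣ m
  ∏pow-∣ {m} []       _                 _                  _    = 1∣ m
  ∏pow-∣     (p ∷ ps) (p∉ps ∷ unique) (p-prime ∷ primes) each =
    coprime-*-∣ pᵛ⊥∏ (each (here refl)) (∏pow-∣ ps unique primes (λ q∈ → each (there q∈)))
    where
    pᵛ⊥∏ : Coprime (p ^ v p) (∏pow ps)
    pᵛ⊥∏ = coprime-by-primes {{m^n≢0 p (v p) {{prime⇒nonZero p-prime}}}} (λ q-prime q∣pᵛ q∣∏ →
      All.lookup p∉ps (subst (_∈ ps) (prime-∣-pow q-prime p-prime (v p) q∣pᵛ)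
                                      (prime-∣-∏pow ps q-prime primes q∣∏)) refl)

J : ℕ → ℕ → List ℕ
J m n = filter (λ p → (p ∣? m) ×-dec ¬? (p ∣? n)) (primesBelow m)

module _ {m n : ℕ} .{{_ : NonZero m}} where

  ∈J⇒ : ∀ {p} → p ∈ J m n → Prime p × p ∣ m × ¬ p ∣ n
  ∈J⇒ p∈ =
    let (p∈primes , p∣m , p∤n) =
          ∈-filter⁻ (λ p → (p ∣? m) ×-dec ¬? (p ∣? n)) {xs = primesBelow m} p∈
    in proj₂ (∈-filter⁻ prime? {xs = upTo (suc m)} p∈primes) , p∣m , p∤n

  ⇒∈J : ∀ {p} → Prime p → p ∣ m → ¬ p ∣ n → p ∈ J m n
  ⇒∈J p-prime p∣m p∤n =
    ∈-filter⁺ (λ p → (p ∣? m) ×-dec ¬? (p ∣? n))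
      (∈-filter⁺ prime? (∈-upTo⁺ (s≤s (∣⇒≤ p∣m))) p-prime) (p∣m , p∤n)

  J-primes : All Prime (J m n)
  J-primes = All.tabulate (λ p∈ → proj₁ (∈J⇒ p∈))

  J-unique : Unique (J m n)
  J-unique = filter⁺ _ (filter⁺ prime? (upTo⁺ (suc m)))

  pow-val-∣ : ∀ {p} → Prime p → p ^ val p m ∣ m
  pow-val-∣ p-prime = let (r , m≡ , _) = val-spec p-prime in divides r (trans m≡ (*-comm _ r))

  pJaJ-∣ : pJaJ m n ∣ m
  pJaJ-∣ = ∏pow-∣ (λ p → val p m) (J m n) J-unique J-primes (λ p∈ → pow-val-∣ (proj₁ (∈J⇒ p∈)))

  pJaJ-coprime : .{{_ : NonZero n}} → Coprime (pJaJ m n) n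
  pJaJ-coprime = ∏pow-coprime (λ p → val p m) (J m n) J-primes
                   (All.tabulate (λ p∈ → proj₂ (proj₂ (∈J⇒ p∈))))

  -- The cofactor M = m / pJaJ m n has only prime factors dividing n: a prime p ∤ n dividing M
  -- would lie in J m n, so p^(v_p(m)) ∣ pJaJ m n and p · p^(v_p(m)) ∣ m, against maximality
  -- of the valuation.
  cofactor-primes-∣n : ∀ {p} → Prime p → p ∣ quotient pJaJ-∣ → p ∣ n
  cofactor-primes-∣n {p} p-prime p∣M with p ∣? n
  ... | yes p∣n = p∣n
  ... | no p∤n  = ⊥-elim (p∤r (∣-trans p∣M M∣r))
    where
    M = quotient pJaJ-∣
    m≡ : m ≡ M * pJaJ m n
    m≡ = m∣n⇒n≡quotient*m pJaJ-∣
    p∈J = ⇒∈J p-prime (∣-trans p∣M (divides (pJaJ m n) (trans m≡ (*-comm M _)))) p∤n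
    pᵛ∣pJ = pow-∣-∏pow (λ p → val p m) p∈J
    Q = quotient pᵛ∣pJ
    v = val p m
    instance
      pᵛ≢0 : NonZero (p ^ v)
      pᵛ≢0 = m^n≢0 p v {{prime⇒nonZero p-prime}}
    spec = val-spec {p} {m} p-prime
    r = proj₁ spec
    p∤r = proj₂ (proj₂ spec)

    M∣r : M ∣ r
    M∣r = divides Q (*-cancelˡ-≡ r (Q * M) (p ^ v) (begin
      p ^ v * r         ≡⟨ proj₁ (proj₂ spec) ⟨
      m                 ≡⟨ m≡ ⟩
      M * pJaJ m n      ≡⟨ cong (M *_) (m∣n⇒n≡quotient*m pᵛ∣pJ) ⟩
      M * (Q * p ^ v)   ≡⟨ rotate M Q (p ^ v) ⟩
      p ^ v * (Q * M)   ∎))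
      where
      rotate : ∀ a b c → a * (b * c) ≡ c * (b * a)
      rotate = solve-∀

  -- ... and it is the largest one: a divisor d of m = M · pJaJ m n coprime to n is coprime
  -- to M, hence divides pJaJ m n.
  pJaJ-maximal : ∀ {d} .{{_ : NonZero d}} → d ∣ m → Coprime d n → d ∣ pJaJ m n
  pJaJ-maximal {d} d∣m d⊥n = coprime-divisor d⊥M (subst (d ∣_) (m∣n⇒n≡quotient*m pJaJ-∣) d∣m)
    where
    d⊥M : Coprime d (quotient pJaJ-∣)
    d⊥M = coprime-by-primes (λ p-prime p∣d p∣M →
      ¬prime[1] (subst Prime (d⊥n (p∣d , cofactor-primes-∣n p-prime p∣M)) p-prime))

divisor-nonZero : ∀ {d N} .{{_ : NonZero N}} → d ∣ N → NonZero d
divisor-nonZero {N = N} d∣N = ≢-nonZero (λ d≡0 → ≢-nonZero⁻¹ N (0∣⇒≡0 (subst (_∣ N) d≡0 d∣N)))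

-- The positive divisors of N, listed as in sumDivisors.
divisors : ℕ → List ℕ
divisors N = filter (_∣? N) (map suc (upTo N))

∈divisors⇒ : ∀ N {d} → d ∈ divisors N → d ∣ N × NonZero d
∈divisors⇒ N d∈ with ∈-filter⁻ (_∣? N) {xs = map suc (upTo N)} d∈
... | d∈sucs , d∣N with ∈-map⁻ suc d∈sucs
...   | _ , _ , refl = d∣N , _

⇒∈divisors : ∀ {N d} .{{_ : NonZero N}} → d ∣ N → NonZero d → d ∈ divisors N
⇒∈divisors {N} {suc d′} d∣N _ = ∈-filter⁺ (_∣? N) (∈-map⁺ suc (∈-upTo⁺ (∣⇒≤ d∣N))) d∣N

divisors-unique : ∀ N → Unique (divisors N)
divisors-unique N = filter⁺ (_∣? N) (map⁺ suc-injective (upTo⁺ N))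

-- Division with a / 0 = 0, as used by rhs.
quot : ℕ → ℕ → ℕ
quot a zero    = 0
quot a (suc d) = a / suc d

quot-exact : ∀ {a g} d .{{_ : NonZero d}} → a ≡ g * d → quot a d ≡ g
quot-exact {g = g} (suc d′) refl = m*n/n≡m g (suc d′)

rhs-as-sum : ∀ m n c →
  rhs m n c ≡ sum (map (λ d → quot m d * c (quot (m * n) d)) (divisors (pJaJ m n)))
rhs-as-sum m n c = cong sum (map-cong (λ { zero → refl ; (suc d) → refl }) (divisors (pJaJ m n)))

record Cofactor (m n d : ℕ) : Set where
  field
    cofactor≢0 : NonZero (quot m d)
    m≡g*d      : m ≡ quot m d * d
    mn/d≡g*n   : quot (m * n) d ≡ quot m d * n
    d⊥n        : Coprime d n

cofactor : ∀ m n {d} .{{_ : NonZero m}} .{{_ : NonZero n}} →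
           d ∈ divisors (pJaJ m n) → Cofactor m n d
cofactor m n {d} d∈ with ∈divisors⇒ (pJaJ m n) d∈
cofactor m n {suc d′} d∈ | d∣pJ , _ = record
  { cofactor≢0 = ≢-nonZero (λ g≡0 → ≢-nonZero⁻¹ m (trans m≡ (cong (_* d) g≡0)))
  ; m≡g*d      = m≡
  ; mn/d≡g*n   = trans (cong (_/ d) (*-comm m n)) (trans (*-/-assoc n d∣m) (*-comm n (m / d)))
  ; d⊥n        = λ (e∣d , e∣n) → pJaJ-coprime {m = m} (∣-trans e∣d d∣pJ , e∣n)
  }
  where
  d = suc d′
  d∣m : d ∣ m
  d∣m = ∣-trans d∣pJ (pJaJ-∣ {n = n})
  m≡ : m ≡ m / d * d
  m≡ = sym (m/n*n≡m d∣m)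

-- Let m = g·d with d coprime to n.  A closed T-orbit of
-- length g·n breaks under T^m into g closed orbits of length n, those of r, T r, ..., T^(g-1) r.
-- So a transversal of size c of the T-orbits of length g·n gives one of size g·c of the
-- T^m-orbits through points of exact T-period g·n.
module _ {X : Set} (T : X → X) {m g d n : ℕ} .{{_ : NonZero g}} .{{_ : NonZero n}}
         (m≡g*d : m ≡ g * d) (d⊥n : Coprime d n) where

  private instance
    gn≢0 : NonZero (g * n)
    gn≢0 = m*n≢0 g n

  split-period : ∀ {y} → ExactPeriod T (g * n) y → ExactPeriod (iter T m) n y
  split-period p = exact-iterate p (λ k →
    subst (λ t → g * n ∣ k * t ⇔ n ∣ k) (sym m≡g*d) (coprime-cancel g d⊥n k))

  -- The points T^j y, j < g, lie on distinct T^m-orbits ...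
  residues-apart : ∀ {y} → ExactPeriod T (g * n) y → ∀ {j j′ k} → j < g → j′ < g →
                   iter T (k * m + j) y ≡ iter T j′ y → j ≡ j′
  residues-apart p {j} {j′} {k} j<g j′<g eq = begin
    j                ≡⟨ m<n⇒m%n≡m j<g ⟨
    j % g            ≡⟨ %-remove-+ˡ j g∣km ⟨
    (k * m + j) % g  ≡⟨ mod-coarsen (m∣m*n n) (exact-mod p eq) ⟩
    j′ % g           ≡⟨ m<n⇒m%n≡m j′<g ⟩
    j′               ∎
    where
    g∣km : g ∣ k * m
    g∣km = ∣n⇒∣m*n k (subst (g ∣_) (sym m≡g*d) (m∣m*n d))

  -- ... and together they meet every T^m-orbit through the T-orbit of y: since d is invertible
  -- modulo n, some T^m-iterate of T^s y is T^(s mod g) y.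
  reach-residue : ∀ {y} → ExactPeriod T (g * n) y → ∀ s →
                  ∃ λ k → iter (iter T m) k (iter T s y) ≡ iter T (s % g) y
  reach-residue {y} p s with coprime-solvable d⊥n (s / g)
  ... | k , n∣kd+q = k , (begin
    iter (iter T m) k (iter T s y)           ≡⟨ iter-* T m k _ ⟩
    iter T (k * m) (iter T s y)              ≡⟨ iter-+ T (k * m) s y ⟨
    iter T (k * m + s) y                     ≡⟨ cong (λ t → iter T t y) time ⟩
    iter T (s % g + g * (k * d + s / g)) y   ≡⟨ iter-+-period T (exact-return p) (s % g) gn∣ ⟩
    iter T (s % g) y                         ∎)
    where
    regroup : ∀ k g d r q → k * (g * d) + (r + q * g) ≡ r + g * (k * d + q)
    regroup = solve-∀

    time : k * m + s ≡ s % g + g * (k * d + s / g)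
    time = trans (cong₂ (λ a b → k * a + b) m≡g*d (m≡m%n+[m/n]*n s g))
                 (regroup k g d (s % g) (s / g))

    gn∣ : g * n ∣ g * (k * d + s / g)
    gn∣ = *-monoʳ-∣ g n∣kd+q

  split-transversal : ∀ {c} → OrbitCount T (g * n) c →
                      Transversal (SameOrbit (iter T m) n) (ExactPeriod T (g * n)) (g * c)
  split-transversal {c} (rep , rep-closed , rep-separated , rep-cover) =
    transversal-via {R = SameOrbit (iter T m) n} *↔× point member separated cover
    where
    rep-exact : ∀ i → ExactPeriod T (g * n) (rep i)
    rep-exact i = closed⇒exact (rep-closed i)

    point : Fin g × Fin c → X
    point (j , i) = iter T (toℕ j) (rep i)

    member : ∀ a → ExactPeriod T (g * n) (point a)
    member (j , i) = exact-shift (rep-exact i) (toℕ j)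

    -- If T^j′ r′ = T^(km + j) r, then r and r′ are on one T-orbit, so r = r′, and j = j′.
    same-time : ∀ {i i′ j j′} k → iter T (toℕ j′) (rep i′) ≡ iter T (k * m + toℕ j) (rep i) →
                (j , i) ≡ (j′ , i′)
    same-time {i} {i′} {j} {j′} k meet
      with rep-separated i i′ (sameOrbit-meet T (exact-return (rep-exact i))
                                 (exact-return (rep-exact i′)) (toℕ j′) (k * m + toℕ j) meet)
    ... | refl = cong (_, i)
      (toℕ-injective (residues-apart (rep-exact i) {k = k} (toℕ<n j) (toℕ<n j′) (sym meet)))

    separated : ∀ a b → SameOrbit (iter T m) n (point a) (point b) → a ≡ b
    separated (j , i) (j′ , i′) same =
      let (k , meet) = sameOrbit-elim (iter T m) same in
      same-time k (trans meet (trans (iter-* T m k _) (sym (iter-+ T (k * m) (toℕ j) (rep i)))))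

    cover : ∀ x → ExactPeriod T (g * n) x → ∃ λ a → SameOrbit (iter T m) n x (point a)
    cover x px with rep-cover x (exact⇒closed px)
    ... | i , x~rep with sameOrbit-elim T (sameOrbit-sym T x~rep)
    ...   | s , refl with reach-residue (rep-exact i) s
    ...     | k , lands = (fromℕ< (m%n<n s g) , i) ,
      subst (SameOrbit (iter T m) n (iter T s (rep i)))
        (trans lands (cong (λ t → iter T t (rep i)) (sym (toℕ-fromℕ< (m%n<n s g)))))
        (sameOrbit-intro (iter T m) (exact-return (split-period px)) k)

module _ {X : Set} (T : X → X) {m n : ℕ} .{{_ : NonZero m}} .{{_ : NonZero n}} where

  Class : ℕ → X → Set
  Class d = ExactPeriod T (quot m d * n)

  -- Each point of a closed T^m-orbit of length n lies in the class of some d ∣ pJaJ m n: if L is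
  -- its exact T-period then L = g·n and m = g·d with d coprime to n, so d ∣ pJaJ m n and g = m/d.
  class-exists : FinitelyManyFixed T (n * m) → ∀ {x} → ClosedOrbit (iter T m) n x →
                 Any (λ d → Class d x) (divisors (pJaJ m n))
  class-exists fixed {x} closed
    with exact-period-exists {{m*n≢0 n m}} fixed (trans (sym (iter-* T m n x)) (proj₁ closed))
  ... | a , px with gcd-structure (exact-iterate⁻ px (closed⇒exact closed))
  ...   | d , L≡g*n , m≡g*d , d⊥n =
    lose d∈ (subst (λ h → ExactPeriod T (h * n) x) g≡m/d (subst (λ L → ExactPeriod T L x) L≡g*n px))
    where
    g = gcd (suc a) m
    d∣m : d ∣ m
    d∣m = divides g m≡g*d
    instance
      pJ≢0 : NonZero (pJaJ m n)
      pJ≢0 = divisor-nonZero (pJaJ-∣ {n = n})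
      d≢0 : NonZero d
      d≢0 = divisor-nonZero d∣m
    d∈ : d ∈ divisors (pJaJ m n)
    d∈ = ⇒∈divisors (pJaJ-maximal d∣m d⊥n) d≢0
    g≡m/d : g ≡ quot m d
    g≡m/d = sym (quot-exact d m≡g*d)

  -- Points in the classes of d and d′ on a common T^m-orbit have the same exact T-period,
  -- so (m/d)·n = (m/d′)·n and d = d′.
  classes-apart : ∀ {d d′ x y} → d ∈ divisors (pJaJ m n) → d′ ∈ divisors (pJaJ m n) →
                  Class d x → Class d′ y → SameOrbit (iter T m) n x y → d ≡ d′
  classes-apart {d} {d′} {x} d∈ d′∈ px py same with sameOrbit-elim (iter T m) same
  ... | k , refl = *-cancelˡ-≡ d d′ (quot m d) {{D.cofactor≢0}} (begin
    quot m d * d    ≡⟨ D.m≡g*d ⟨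
    m               ≡⟨ D′.m≡g*d ⟩
    quot m d′ * d′  ≡⟨ cong (_* d′) g′≡g ⟩
    quot m d * d′   ∎)
    where
    module D  = Cofactor (cofactor m n d∈)
    module D′ = Cofactor (cofactor m n d′∈)
    px′ : Class d (iter T (k * m) x)
    px′ = exact-shift {{m*n≢0 (quot m d) n {{D.cofactor≢0}}}} px (k * m)
    g′≡g : quot m d′ ≡ quot m d
    g′≡g = *-cancelʳ-≡ _ _ n (exact-unique py (subst (Class d) (sym (iter-* T m k x)) px′))

  -- The closed T^m-orbits of length n form the disjoint union of the classes of the
  -- divisors d of pJaJ m n, and the class of d has a transversal of size (m/d) · c(mn/d).
  iterate-orbit-count : FinitelyManyFixed T (n * m) →
                        (c : ℕ → ℕ) → (∀ k → 1 ≤ k → OrbitCount T k (c k)) →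
                        OrbitCount (iter T m) n (rhs m n c)
  iterate-orbit-count fixed c counts =
    subst (OrbitCount (iter T m) n) (sym (rhs-as-sum m n c))
      (transversal-≐ {R = SameOrbit (iter T m) n} closed-of-class (class-exists fixed)
        (transversal-⋃ Class (λ d → quot m d * c (quot (m * n) d)) (sameOrbit-sym (iter T m))
           (divisors (pJaJ m n)) (divisors-unique (pJaJ m n)) class-transversal classes-apart))
    where
    closed-of-class : ∀ {x} → Any (λ d → Class d x) (divisors (pJaJ m n)) →
                      ClosedOrbit (iter T m) n x
    closed-of-class in-class =
      let (d , d∈ , px) = find in-class
          open Cofactor (cofactor m n d∈)
      in exact⇒closed (split-period T {{cofactor≢0}} m≡g*d d⊥n px)

    class-transversal : ∀ {d} → d ∈ divisors (pJaJ m n) →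
      Transversal (SameOrbit (iter T m) n) (Class d) (quot m d * c (quot (m * n) d))
    class-transversal {d} d∈ =
      split-transversal T {{cofactor≢0}} m≡g*d d⊥n
        (subst (λ L → OrbitCount T L (c (quot (m * n) d))) mn/d≡g*n
          (counts (quot (m * n) d) mn/d≥1))
      where
      open Cofactor (cofactor m n d∈)
      mn/d≥1 : 1 ≤ quot (m * n) d
      mn/d≥1 = subst (1 ≤_) (sym mn/d≡g*n) (>-nonZero⁻¹ _ {{m*n≢0 _ n {{cofactor≢0}}}})

theorem2p1 : {X : Set} (T : X → X) (m : ℕ) → 1 ≤ m →
    (∀ n → 1 ≤ n → FinitelyManyFixed T n) →
    Σ (ℕ → ℕ) (λ c → ∀ k → 1 ≤ k → OrbitCount T k (c k))
    × ((c : ℕ → ℕ) → (∀ k → 1 ≤ k → OrbitCount T k (c k)) →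
       ∀ n → 1 ≤ n → OrbitCount (iter T m) n (rhs m n c))
theorem2p1 T m 1≤m fixed = (count , count-correct) , iterate-counts
  where
  orbits : ∀ k → Σ ℕ (OrbitCount T (suc k))
  orbits k = orbit-count T (suc k) (fixed (suc k) (s≤s z≤n))

  count : ℕ → ℕ
  count zero    = 0
  count (suc k) = proj₁ (orbits k)

  count-correct : ∀ k → 1 ≤ k → OrbitCount T k (count k)
  count-correct (suc k) _ = proj₂ (orbits k)

  iterate-counts : (c : ℕ → ℕ) → (∀ k → 1 ≤ k → OrbitCount T k (c k)) →
                   ∀ n → 1 ≤ n → OrbitCount (iter T m) n (rhs m n c)
  iterate-counts c counts n 1≤n = iterate-orbit-count T (fixed (n * m) 1≤nm) c counts
    where
    instance
      m≢0 : NonZero m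
      m≢0 = >-nonZero 1≤m
      n≢0 : NonZero n
      n≢0 = >-nonZero 1≤n
    1≤nm : 1 ≤ n * m
    1≤nm = >-nonZero⁻¹ (n * m) {{m*n≢0 n m}}
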